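{- Let $\ell\ge 0$ be an integer and $G=(X,Y,E)$ a bipartite graph. If $|\mathfrak{B}_\ell(G)|>\ell^2+\ell$, then $G$ contains a matching of size $\ell+1$.
   Context: For a bipartite graph $G=(X,Y,E)$ with fixed bipartition, a vertex $v$ with degree $d(v)>\ell$ is $\ell$-important, otherwise $\ell$-unimportant. The Buss selector $\mathfrak{B}_\ell(G)$ is the set of all vertices of $X$ that are $\ell$-important or have at least one $\ell$-unimportant neighbour. -}

module Defs where

open import Data.Nat using (ℕ; _<_; _≤_; _+_; _*_)
open import Data.Bool using (Bool; true; false; _∨_; _∧_; not)
open import Data.Fin using (Fin)
open import Data.Vec using (Vec; tabulate; count)
open import Data.Vec.Functional using () renaming (Vector to FVec)
open import Data.Fin.Subset using (Subset; ∣_∣)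
open import Data.List using (List)
open import Data.Nat using (_<ᵇ_; _≤ᵇ_)
open import Relation.Binary.PropositionalEquality using (_≡_)
open import Data.Product using (Σ; _×_)
open import Function.Definitions using (Injective)

-- A finite bipartite graph G = (X, Y, E) with fixed bipartition:
-- X = Fin m, Y = Fin n (disjoint sides), E ⊆ X × Y given as a Boolean relation.
record BipGraph (m n : ℕ) : Set where
  field
    E : Fin m → Fin n → Bool
open BipGraph public

countTrue : ∀ {k} → (Fin k → Bool) → ℕ
countTrue {k} f = ∣ tabulate f ∣

degX : ∀ {m n} → BipGraph m n → Fin m → ℕ
degX G x = countTrue (λ y → E G x y)

degY : ∀ {m n} → BipGraph m n → Fin n → ℕ
degY G y = countTrue (λ x → E G x y)

importantXᵇ : ∀ {m n} → ℕ → BipGraph m n → Fin m → Bool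
importantXᵇ ℓ G x = ℓ <ᵇ degX G x

unimportantYᵇ : ∀ {m n} → ℕ → BipGraph m n → Fin n → Bool
unimportantYᵇ ℓ G y = degY G y ≤ᵇ ℓ

anyNbr : ∀ {m n} → BipGraph m n → (Fin n → Bool) → Fin m → Bool
anyNbr G p x = 0 <ᵇ countTrue (λ y → E G x y ∧ p y)

buss : ∀ {m n} → ℕ → BipGraph m n → Subset m
buss ℓ G = tabulate (λ x → importantXᵇ ℓ G x ∨ anyNbr G (unimportantYᵇ ℓ G) x)

-- A matching of size k: k edges (f i, g i) with pairwise distinct X-endpoints
-- and pairwise distinct Y-endpoints (X, Y disjoint, so edges are disjoint).
HasMatching : ∀ {m n} → BipGraph m n → ℕ → Set
HasMatching {m} {n} G k =
  Σ (Fin k → Fin m) λ f → Σ (Fin k → Fin n) λ g →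
    Injective _≡_ _≡_ f × Injective _≡_ _≡_ g × (∀ i → E G (f i) (g i) ≡ true)

module Submission where

-- Matchings are grown greedily.  Let M be a matching of size k ≤ ℓ.  Call x ∈ X
-- blocked by M if x is an X-endpoint of M or x is adjacent to an ℓ-unimportant
-- Y-endpoint of M.  At most k + k·ℓ ≤ ℓ² + ℓ vertices are blocked, so the selector
-- contains an unblocked x.  If x is ℓ-important it has more than ℓ ≥ k neighbours,
-- so some neighbour y is not a Y-endpoint of M; otherwise x has an ℓ-unimportant
-- neighbour y, which is not a Y-endpoint of M because x is unblocked.  Either way
-- M + xy is a matching of size k + 1, and ℓ + 1 such steps from the empty matching
-- give the lemma.

open import Defs
open import Data.Nat using (ℕ; _<_; _+_; _*_; suc)
open import Data.Fin.Subset using (∣_∣)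

open import Data.Nat using (zero; _≤_; z≤n; s≤s)
open import Data.Nat.Properties
  using (≤-refl; ≤-trans; ≤-reflexive; ≤-<-trans; <-≤-trans; +-suc; +-monoʳ-≤; +-mono-≤;
         *-monoˡ-≤; *-identityʳ; +-comm; n≤1+n; m≤n⇒m≤1+n; >⇒≢; +-cancelʳ-<; ≤ᵇ⇒≤; <ᵇ⇒<)
open import Data.Bool using (Bool; true; false; T; if_then_else_; _∧_)
open import Data.Bool.Properties using (T-≡; T-∨; T-∧)
open import Data.Fin using (Fin; zero; suc)
open import Data.Fin.Subset
  using (Subset; inside; outside; _∈_; _∉_; _⊆_; _∪_; _─_; ⊥; ⁅_⁆; Nonempty)
open import Data.Fin.Subset.Properties
  using (_∈?_; nonempty?; Empty-unique; ∣⊥∣≡0; ∉⊥; ∣⁅x⁆∣≡1; x∈⁅x⁆; x∈⁅y⁆⇒x≡y; p⊆q⇒∣p∣≤∣q∣;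
         x∈p∪q⁺; x∈p∪q⁻; x∈p∧x∉q⇒x∈p─q; p─q⊆p)
open import Data.Vec using (_∷_; []; tabulate; here; there)
open import Data.Vec.Properties using (lookup∘tabulate; lookup⇒[]=; []=⇒lookup)
import Data.Vec.Functional as Vector
open import Data.Product using (_×_; _,_; ∃-syntax)
import Data.Product as Product
open import Data.Sum using (inj₁; inj₂)
open import Function using (_∘_; id; Equivalence; Injective)
open import Relation.Nullary using (yes; no; contradiction)
open import Relation.Binary.PropositionalEquality using (_≡_; refl; sym; trans; cong; subst)

private variable
  k m n : ℕ

open Equivalence using (to; from)

∈-tabulate⁺ : ∀ {f : Fin n → Bool} {x} → T (f x) → x ∈ tabulate f
∈-tabulate⁺ {f = f} {x} fx = lookup⇒[]= x (tabulate f) (trans (lookup∘tabulate f x) (to T-≡ fx))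

∈-tabulate⁻ : ∀ {f : Fin n → Bool} {x} → x ∈ tabulate f → T (f x)
∈-tabulate⁻ {f = f} {x} x∈ = from T-≡ (trans (sym (lookup∘tabulate f x)) ([]=⇒lookup x∈))

x∈p─q⇒x∉q : ∀ {p q : Subset n} {x} → x ∈ p ─ q → x ∉ q
x∈p─q⇒x∉q {p = _ ∷ _} {inside ∷ _} () here
x∈p─q⇒x∉q {p = _ ∷ _} {_ ∷ _} (there x∈p─q) (there x∈q) = x∈p─q⇒x∉q x∈p─q x∈q

∣p∪q∣≤∣p∣+∣q∣ : ∀ (p q : Subset n) → ∣ p ∪ q ∣ ≤ ∣ p ∣ + ∣ q ∣
∣p∪q∣≤∣p∣+∣q∣ []            []            = z≤n
∣p∪q∣≤∣p∣+∣q∣ (outside ∷ p) (outside ∷ q) = ∣p∪q∣≤∣p∣+∣q∣ p q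
∣p∪q∣≤∣p∣+∣q∣ (outside ∷ p) (inside  ∷ q) =
  ≤-trans (s≤s (∣p∪q∣≤∣p∣+∣q∣ p q)) (≤-reflexive (sym (+-suc (∣ p ∣) (∣ q ∣))))
∣p∪q∣≤∣p∣+∣q∣ (inside  ∷ p) (outside ∷ q) = s≤s (∣p∪q∣≤∣p∣+∣q∣ p q)
∣p∪q∣≤∣p∣+∣q∣ (inside  ∷ p) (inside  ∷ q) =
  s≤s (≤-trans (∣p∪q∣≤∣p∣+∣q∣ p q) (+-monoʳ-≤ (∣ p ∣) (n≤1+n (∣ q ∣))))

∣p∣≤∣p─q∣+∣q∣ : ∀ (p q : Subset n) → ∣ p ∣ ≤ ∣ p ─ q ∣ + ∣ q ∣
∣p∣≤∣p─q∣+∣q∣ p q = ≤-trans (p⊆q⇒∣p∣≤∣q∣ split) (∣p∪q∣≤∣p∣+∣q∣ (p ─ q) q)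
  where
  split : p ⊆ (p ─ q) ∪ q
  split {x} x∈p with x ∈? q
  ... | yes x∈q = x∈p∪q⁺ (inj₂ x∈q)
  ... | no  x∉q = x∈p∪q⁺ (inj₁ (x∈p∧x∉q⇒x∈p─q x∈p x∉q))

∣p∣>0⇒nonempty : ∀ (p : Subset n) → 0 < ∣ p ∣ → Nonempty p
∣p∣>0⇒nonempty {n} p 0<∣p∣ with nonempty? p
... | yes ne  = ne
... | no  ¬ne = contradiction (trans (cong ∣_∣ (Empty-unique ¬ne)) (∣⊥∣≡0 n)) (>⇒≢ 0<∣p∣)

outside-smaller : ∀ (p q : Subset n) → ∣ q ∣ < ∣ p ∣ → ∃[ x ] (x ∈ p × x ∉ q)
outside-smaller p q ∣q∣<∣p∣ with ∣p∣>0⇒nonempty (p ─ q) 0<∣p─q∣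
  where
  0<∣p─q∣ : 0 < ∣ p ─ q ∣
  0<∣p─q∣ = +-cancelʳ-< (∣ q ∣) 0 (∣ p ─ q ∣) (<-≤-trans ∣q∣<∣p∣ (∣p∣≤∣p─q∣+∣q∣ p q))
... | x , x∈p─q = x , p─q⊆p p q x∈p─q , x∈p─q⇒x∉q x∈p─q

⋃ᶠ : (Fin k → Subset n) → Subset n
⋃ᶠ {zero}  P = ⊥
⋃ᶠ {suc k} P = P zero ∪ ⋃ᶠ (P ∘ suc)

∈⋃ᶠ⁺ : ∀ (P : Fin k → Subset n) i {x} → x ∈ P i → x ∈ ⋃ᶠ P
∈⋃ᶠ⁺ P zero    x∈Pi = x∈p∪q⁺ (inj₁ x∈Pi)
∈⋃ᶠ⁺ P (suc i) x∈Pi = x∈p∪q⁺ (inj₂ (∈⋃ᶠ⁺ (P ∘ suc) i x∈Pi))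

∈⋃ᶠ⁻ : ∀ (P : Fin k → Subset n) {x} → x ∈ ⋃ᶠ P → ∃[ i ] x ∈ P i
∈⋃ᶠ⁻ {zero}  P x∈⊥ = contradiction x∈⊥ ∉⊥
∈⋃ᶠ⁻ {suc k} P x∈⋃ with x∈p∪q⁻ (P zero) (⋃ᶠ (P ∘ suc)) x∈⋃
... | inj₁ x∈P₀   = zero , x∈P₀
... | inj₂ x∈rest = Product.map suc id (∈⋃ᶠ⁻ (P ∘ suc) x∈rest)

∣⋃ᶠ∣≤ : ∀ (P : Fin k → Subset n) b → (∀ i → ∣ P i ∣ ≤ b) → ∣ ⋃ᶠ P ∣ ≤ k * b
∣⋃ᶠ∣≤ {zero} {n} P b _ = ≤-reflexive (∣⊥∣≡0 n)
∣⋃ᶠ∣≤ {suc k} P b small =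
  ≤-trans (∣p∪q∣≤∣p∣+∣q∣ (P zero) _) (+-mono-≤ (small zero) (∣⋃ᶠ∣≤ (P ∘ suc) b (small ∘ suc)))

image : (Fin k → Fin n) → Subset n
image f = ⋃ᶠ (⁅_⁆ ∘ f)

∈image⁺ : ∀ (f : Fin k → Fin n) i → f i ∈ image f
∈image⁺ f i = ∈⋃ᶠ⁺ (⁅_⁆ ∘ f) i (x∈⁅x⁆ (f i))

∈image⁻ : ∀ (f : Fin k → Fin n) {y} → y ∈ image f → ∃[ i ] f i ≡ y
∈image⁻ f y∈ = Product.map id (sym ∘ x∈⁅y⁆⇒x≡y _) (∈⋃ᶠ⁻ (⁅_⁆ ∘ f) y∈)

∣image∣≤ : ∀ (f : Fin k → Fin n) → ∣ image f ∣ ≤ k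
∣image∣≤ {k} f = ≤-trans (∣⋃ᶠ∣≤ (⁅_⁆ ∘ f) 1 (≤-reflexive ∘ ∣⁅x⁆∣≡1 ∘ f)) (≤-reflexive (*-identityʳ k))

∷-injective : ∀ {f : Fin k → Fin n} {x} →
  Injective _≡_ _≡_ f → x ∉ image f → Injective _≡_ _≡_ (x Vector.∷ f)
∷-injective             inj x∉ {zero}  {zero}  _     = refl
∷-injective {f = f}     inj x∉ {zero}  {suc j} x≡fj  = contradiction (subst (_∈ image f) (sym x≡fj) (∈image⁺ f j)) x∉
∷-injective {f = f}     inj x∉ {suc i} {zero}  fi≡x  = contradiction (subst (_∈ image f) fi≡x (∈image⁺ f i)) x∉
∷-injective             inj x∉ {suc i} {suc j} fi≡fj = cong suc (inj fi≡fj)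

emptyMatching : (G : BipGraph m n) → HasMatching G 0
emptyMatching G = (λ ()) , (λ ()) , (λ { {()} }) , (λ { {()} }) , (λ ())

matchedX : (G : BipGraph m n) → HasMatching G k → Subset m
matchedX G (f , _) = image f

matchedY : (G : BipGraph m n) → HasMatching G k → Subset n
matchedY G (_ , g , _) = image g

extendMatching : {G : BipGraph m n} (M : HasMatching G k) {x : Fin m} {y : Fin n} →
  x ∉ matchedX G M → y ∉ matchedY G M → T (E G x y) → HasMatching G (suc k)
extendMatching {G = G} (f , g , inj-f , inj-g , edges) {x} {y} x∉ y∉ xy =
  x Vector.∷ f , y Vector.∷ g , ∷-injective inj-f x∉ , ∷-injective inj-g y∉ , edges′
  where
  edges′ : ∀ i → E G ((x Vector.∷ f) i) ((y Vector.∷ g) i) ≡ true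
  edges′ zero    = to T-≡ xy
  edges′ (suc i) = edges i

module Augmentation (ℓ : ℕ) (G : BipGraph m n) where

  Nˣ : Fin m → Subset n
  Nˣ x = tabulate (E G x)

  Nʸ : Fin n → Subset m
  Nʸ y = tabulate (λ x → E G x y)

  shadow : Fin n → Subset m
  shadow y = if unimportantYᵇ ℓ G y then Nʸ y else ⊥

  ∣shadow∣≤ℓ : ∀ y → ∣ shadow y ∣ ≤ ℓ
  ∣shadow∣≤ℓ y with unimportantYᵇ ℓ G y in unimportant
  ... | true  = ≤ᵇ⇒≤ (degY G y) ℓ (from T-≡ unimportant)
  ... | false = ≤-trans (≤-reflexive (∣⊥∣≡0 m)) z≤n

  nbr∈shadow : ∀ {x y} → T (E G x y) → T (unimportantYᵇ ℓ G y) → x ∈ shadow y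
  nbr∈shadow {y = y} xy unimportant with unimportantYᵇ ℓ G y
  ... | true = ∈-tabulate⁺ xy

  blocked : HasMatching G k → Subset m
  blocked (f , g , _) = image f ∪ ⋃ᶠ (shadow ∘ g)

  ∣blocked∣≤ : (M : HasMatching G k) → ∣ blocked M ∣ ≤ k + k * ℓ
  ∣blocked∣≤ (f , g , _) =
    ≤-trans (∣p∪q∣≤∣p∣+∣q∣ (image f) _) (+-mono-≤ (∣image∣≤ f) (∣⋃ᶠ∣≤ (shadow ∘ g) ℓ (∣shadow∣≤ℓ ∘ g)))

  -- An unblocked ℓ-important vertex has a neighbour outside the matching,
  -- since it has more than ℓ ≥ k neighbours.
  extendAtImportant : k ≤ ℓ → (M : HasMatching G k) {x : Fin m} →
    x ∉ blocked M → T (importantXᵇ ℓ G x) → HasMatching G (suc k)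
  extendAtImportant k≤ℓ M@(f , g , _) {x} x∉blocked important
    with outside-smaller (Nˣ x) (image g) (≤-<-trans (≤-trans (∣image∣≤ g) k≤ℓ) ℓ<deg)
    where
    ℓ<deg : ℓ < degX G x
    ℓ<deg = <ᵇ⇒< ℓ (degX G x) important
  ... | y , y∈Nx , y∉ = extendMatching M (x∉blocked ∘ x∈p∪q⁺ ∘ inj₁) y∉ (∈-tabulate⁻ y∈Nx)

  -- An unblocked vertex with an ℓ-unimportant neighbour y can be matched to y:
  -- were y matched, it would shadow x.
  extendAtUnimportantNbr : (M : HasMatching G k) {x : Fin m} →
    x ∉ blocked M → T (anyNbr G (unimportantYᵇ ℓ G) x) → HasMatching G (suc k)
  extendAtUnimportantNbr M@(f , g , _) {x} x∉blocked hasNbr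
    with ∣p∣>0⇒nonempty (tabulate (λ y → E G x y ∧ unimportantYᵇ ℓ G y)) (<ᵇ⇒< 0 _ hasNbr)
  ... | y , y∈ with to (T-∧ {E G x y}) (∈-tabulate⁻ {f = λ y → E G x y ∧ unimportantYᵇ ℓ G y} y∈)
  ... | xy , unimportant = extendMatching M (x∉blocked ∘ x∈p∪q⁺ ∘ inj₁) y∉ xy
    where
    y∉ : y ∉ image g
    y∉ y∈img with ∈image⁻ g y∈img
    ... | i , refl = x∉blocked (x∈p∪q⁺ (inj₂ (∈⋃ᶠ⁺ (shadow ∘ g) i (nbr∈shadow {x} {g i} xy unimportant))))

  -- A matching of size k ≤ ℓ extends when the selector has more than ℓ² + ℓ
  -- elements: some selector vertex is unblocked.
  augment : k ≤ ℓ → ℓ * ℓ + ℓ < ∣ buss ℓ G ∣ → HasMatching G k → HasMatching G (suc k)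
  augment {k} k≤ℓ large M
    with outside-smaller (buss ℓ G) (blocked M) (≤-<-trans (≤-trans (∣blocked∣≤ M) k+kℓ≤ℓ²+ℓ) large)
    where
    k+kℓ≤ℓ²+ℓ : k + k * ℓ ≤ ℓ * ℓ + ℓ
    k+kℓ≤ℓ²+ℓ = ≤-trans (≤-reflexive (+-comm k (k * ℓ))) (+-mono-≤ (*-monoˡ-≤ ℓ k≤ℓ) k≤ℓ)
  ... | x , x∈buss , x∉blocked with to T-∨ (∈-tabulate⁻ x∈buss)
  ... | inj₁ important = extendAtImportant k≤ℓ M x∉blocked important
  ... | inj₂ hasNbr    = extendAtUnimportantNbr M x∉blocked hasNbr

  matchingsUpTo : ℓ * ℓ + ℓ < ∣ buss ℓ G ∣ → ∀ k → k ≤ suc ℓ → HasMatching G k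
  matchingsUpTo large zero    _         = emptyMatching G
  matchingsUpTo large (suc k) (s≤s k≤ℓ) = augment k≤ℓ large (matchingsUpTo large k (m≤n⇒m≤1+n k≤ℓ))

lemma30 : (ℓ m n : ℕ) (G : BipGraph m n) →
    ℓ * ℓ + ℓ < ∣ buss ℓ G ∣ → HasMatching G (suc ℓ)
lemma30 ℓ m n G large = Augmentation.matchingsUpTo ℓ G large (suc ℓ) ≤-refl
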